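{- Let $G$ be a finite group of order $n=(r+z)^2+z+1$ and let $S=S_1\cup S_2\subseteq G\setminus\{1\}$ with $S_1=S_1^{ -1}$, $S_2\cap S_2^{ -1}=\emptyset$, $|S_1|=r$, $|S_2|=z$. Suppose the Cayley graph $\Gamma=\mathrm{Cay}(G,S)$ is a mixed Moore graph of diameter 2, undirected degree $r$ and directed degree $z$. Then: (i) no element of $S_1$ has order 3 or 4; (ii) no element of $S_2$ is an involution; (iii) no pair of elements of $S_1$ has a product of order 2; (iv) no two distinct elements of $S$ commute, apart from the inverse pairs $\{s,s^{ -1}\}$ in $S_1$; (v) $S$ is product-free, i.e. $S\cap SS=\emptyset$; (vi) all non-identity products of two elements of $S$ are unique: if $s_1s_2=t_1t_2\neq 1$ with $s_1,s_2,t_1,t_2\in S$ then $s_1=t_1$ and $s_2=t_2$; (vii) the elements of $S_2$ are of two types: elements of order 3, and elements belonging to triples $\{a,b,c\}\subseteq S_2$ of distinct elements, each of order at least 4, such that $(ab)^{ -1}=c$.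
   Context: For a finite group $G$ and $S\subseteq G\setminus\{1\}$, the Cayley graph $\mathrm{Cay}(G,S)$ has vertex set $G$ and an arc from $g$ to $gs$ for every $g\in G$, $s\in S$. When $s,s^{ -1}\in S$ the pair of arcs between $g$ and $gs$ is regarded as one undirected edge. Thus with $S=S_1\cup S_2$, $S_1=S_1^{ -1}$, $S_2\cap S_2^{ -1}=\emptyset$, $\mathrm{Cay}(G,S)$ is a mixed graph of undirected degree $|S_1|$ and directed out-degree $|S_2|$. In a mixed graph, undirected edges may be traversed in either direction and arcs only in their direction; distance and diameter are defined accordingly. A mixed Moore graph of diameter 2, undirected degree $r$ and directed degree $z$ is a mixed graph of diameter 2 with every vertex having at most $r$ undirected edges and at most $z$ out-arcs, and with exactly $(z+r)^2+z+1$ vertices. -}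

module Defs where

open import Data.Nat using (ℕ; zero; suc; _≤_; _<_)
open import Data.Fin using (Fin)
open import Data.Fin.Subset using (Subset; _∈_)
open import Data.List using (List; length)
open import Data.List.Relation.Unary.All using (All)
open import Data.List.Relation.Unary.Unique.Propositional using (Unique)
open import Data.Product using (Σ; ∃; _×_)
open import Data.Sum using (_⊎_)
open import Relation.Binary.PropositionalEquality using (_≡_; _≢_)
open import Relation.Nullary using (¬_)

record MixedGraph (n : ℕ) : Set₁ where
  field
    edge : Fin n → Fin n → Set
    arc  : Fin n → Fin n → Set

module _ {n : ℕ} (Γ : MixedGraph n) where
  open MixedGraph Γ

  Step : Fin n → Fin n → Set
  Step u v = edge u v ⊎ edge v u ⊎ arc u v

  Within : ℕ → Fin n → Fin n → Set
  Within zero    u v = u ≡ v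
  Within (suc k) u v = Within k u v ⊎ (∃ λ w → Step u w × Within k w v)

  Diameter2 : Set
  Diameter2 = (∀ u v → Within 2 u v) × (∃ λ u → ∃ λ v → ¬ Within 1 u v)

  UndirDegreeAtMost : ℕ → Set
  UndirDegreeAtMost r = ∀ v (xs : List (Fin n)) → Unique xs →
    All (λ u → edge v u ⊎ edge u v) xs → length xs ≤ r

  OutDegreeAtMost : ℕ → Set
  OutDegreeAtMost z = ∀ v (xs : List (Fin n)) → Unique xs →
    All (arc v) xs → length xs ≤ z

  MixedMoore2 : ℕ → ℕ → Set
  MixedMoore2 r z = Diameter2 × UndirDegreeAtMost r × OutDegreeAtMost z ×
    n ≡ (z Data.Nat.+ r) Data.Nat.^ 2 Data.Nat.+ z Data.Nat.+ 1

Cay : {n : ℕ} (_∙_ : Fin n → Fin n → Fin n) (S₁ S₂ : Subset n) → MixedGraph n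
Cay _∙_ S₁ S₂ = record
  { edge = λ g h → ∃ λ s → s ∈ S₁ × h ≡ g ∙ s
  ; arc  = λ g h → ∃ λ s → s ∈ S₂ × h ≡ g ∙ s
  }

module _ {n : ℕ} (_∙_ : Fin n → Fin n → Fin n) (ε : Fin n) where

  pow : Fin n → ℕ → Fin n
  pow g zero    = ε
  pow g (suc k) = g ∙ pow g k

  HasOrder : Fin n → ℕ → Set
  HasOrder g k = 1 ≤ k × pow g k ≡ ε × (∀ j → 1 ≤ j → j < k → pow g j ≢ ε)

module Submission where

-- Count, for every g, the words of length at most 2 over S (the empty word, s, and s t)
-- whose value is g.  There are 1 + k + k² of them, k = r + z, and this is exactly n + r.
-- Diameter 2 gives every g ≠ 1 at least one such word, and the identity has at least
-- r + 1 (the empty word and the words s s⁻¹, s ∈ S₁).  Hence every g ≠ 1 is the value of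
-- exactly one word: S is product-free and its non-identity products are unique, and
-- (i)–(vii) follow from these two facts by short computations in the group.

open import Defs
open import Data.Nat using (ℕ; _+_; _^_; _≤_)
open import Data.Fin using (Fin)
open import Data.Fin.Subset using (Subset; _∈_; _∉_; _∪_; ∣_∣)
open import Data.Product using (∃; _×_)
open import Data.Sum using (_⊎_)
open import Algebra.Structures using (IsGroup)
open import Relation.Binary.PropositionalEquality using (_≡_; _≢_)
open import Relation.Nullary using (¬_)

open import Algebra.Bundles using (Group)
open import Data.Bool using (true; false; if_then_else_)
open import Data.Fin using (zero; suc; _≟_)
open import Data.Fin.Subset using (inside; outside; ⁅_⁆)
open import Data.Fin.Subset.Properties
  using (_∈?_; x∈⁅x⁆; x∈⁅y⁆⇒x≡y; ∣⁅x⁆∣≡1; x∈p∪q⁺; x∈p∪q⁻)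
open import Data.Nat using (zero; suc; _*_; _<_; z≤n; s≤s)
open import Data.Nat.Properties hiding (_≟_)
open import Data.Nat.Tactic.RingSolver using (solve-∀)
open import Algebra.Properties.Semiring.Sum +-*-semiring
  using (sum; ∑-comm; ∑-distrib-+; *-distribˡ-sum; *-distribʳ-sum; sum-cong-≗)
open import Data.Product using (_,_; proj₁; proj₂; ∃₂; uncurry)
open import Data.Sum using (inj₁; inj₂)
open import Data.Vec using (_∷_; []; lookup)
open import Data.Vec.Properties using ([]=⇒lookup; lookup⇒[]=)
open import Function using (_∘_; id)
open import Relation.Binary.PropositionalEquality
  using (refl; sym; trans; cong; cong₂; subst; module ≡-Reasoning)
open import Relation.Nullary using (yes; no; contradiction)

sum-const-1 : ∀ {n} → sum {n} (λ _ → 1) ≡ n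
sum-const-1 {zero}  = refl
sum-const-1 {suc n} = cong suc (sum-const-1 {n})

sum-mono-≤ : ∀ {n} {f g : Fin n → ℕ} → (∀ i → f i ≤ g i) → sum f ≤ sum g
sum-mono-≤ {zero}  _   = z≤n
sum-mono-≤ {suc n} f≤g = +-mono-≤ (f≤g zero) (sum-mono-≤ (f≤g ∘ suc))

term≤sum : ∀ {n} (f : Fin n → ℕ) i → f i ≤ sum f
term≤sum f zero    = m≤m+n (f zero) _
term≤sum f (suc i) = ≤-trans (term≤sum (f ∘ suc) i) (m≤n+m _ (f zero))

two-terms≤sum : ∀ {n} (f : Fin n → ℕ) {i j} → i ≢ j → f i + f j ≤ sum f
two-terms≤sum f {zero}  {zero}  i≢j = contradiction refl i≢j
two-terms≤sum f {zero}  {suc j} _   = +-monoʳ-≤ (f zero) (term≤sum (f ∘ suc) j)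
two-terms≤sum f {suc i} {zero}  _   =
  ≤-trans (≤-reflexive (+-comm (f (suc i)) (f zero))) (two-terms≤sum f {zero} (λ ()))
two-terms≤sum f {suc i} {suc j} i≢j =
  ≤-trans (two-terms≤sum (f ∘ suc) (i≢j ∘ cong suc)) (m≤n+m _ (f zero))

sum-mono-≤-tight : ∀ {n} {f g : Fin n → ℕ} → (∀ i → f i ≤ g i) → sum g ≤ sum f →
                   ∀ i → g i ≤ f i
sum-mono-≤-tight {suc n} {f} {g} f≤g Σg≤Σf zero = +-cancelʳ-≤ _ (g zero) (f zero)
  (≤-trans (+-monoʳ-≤ (g zero) (sum-mono-≤ (f≤g ∘ suc))) Σg≤Σf)
sum-mono-≤-tight {suc n} {f} {g} f≤g Σg≤Σf (suc i) = sum-mono-≤-tight (f≤g ∘ suc)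
  (+-cancelˡ-≤ (f zero) _ _ (≤-trans (+-monoˡ-≤ _ (f≤g zero)) Σg≤Σf)) i

𝟙 : ∀ {n} → Subset n → Fin n → ℕ
𝟙 p i = if lookup p i then 1 else 0

sum-𝟙 : ∀ {n} (p : Subset n) → sum (𝟙 p) ≡ ∣ p ∣
sum-𝟙 []            = refl
sum-𝟙 (inside  ∷ p) = cong suc (sum-𝟙 p)
sum-𝟙 (outside ∷ p) = sum-𝟙 p

∈⇒𝟙≡1 : ∀ {n} {p : Subset n} {i} → i ∈ p → 𝟙 p i ≡ 1
∈⇒𝟙≡1 i∈p = cong (if_then 1 else 0) ([]=⇒lookup i∈p)

∉⇒𝟙≡0 : ∀ {n} {p : Subset n} {i} → i ∉ p → 𝟙 p i ≡ 0
∉⇒𝟙≡0 {p = p} {i} i∉p with lookup p i in eq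
... | true  = contradiction (lookup⇒[]= i p eq) i∉p
... | false = refl

𝟙≤ : ∀ {n} {p : Subset n} {i m} → (i ∈ p → 1 ≤ m) → 𝟙 p i ≤ m
𝟙≤ {p = p} {i} h with i ∈? p
... | yes i∈p = subst (_≤ _) (sym (∈⇒𝟙≡1 i∈p)) (h i∈p)
... | no  i∉p = subst (_≤ _) (sym (∉⇒𝟙≡0 i∉p)) z≤n

fibre : ∀ {m n} → (Fin m → ℕ) → (Fin m → Fin n) → Fin n → ℕ
fibre c f y = sum (λ i → c i * 𝟙 ⁅ f i ⁆ y)

sum-fibre : ∀ {m n} (c : Fin m → ℕ) (f : Fin m → Fin n) → sum (fibre c f) ≡ sum c
sum-fibre c f = begin
  sum (λ y → sum (λ i → c i * 𝟙 ⁅ f i ⁆ y))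
    ≡⟨ ∑-comm (λ y i → c i * 𝟙 ⁅ f i ⁆ y) ⟩
  sum (λ i → sum (λ y → c i * 𝟙 ⁅ f i ⁆ y))
    ≡⟨ sum-cong-≗ (λ i → sym (*-distribˡ-sum (c i) (𝟙 ⁅ f i ⁆))) ⟩
  sum (λ i → c i * sum (𝟙 ⁅ f i ⁆))
    ≡⟨ sum-cong-≗ (λ i → cong (c i *_) (trans (sum-𝟙 ⁅ f i ⁆) (∣⁅x⁆∣≡1 (f i)))) ⟩
  sum (λ i → c i * 1)
    ≡⟨ sum-cong-≗ (λ i → *-identityʳ (c i)) ⟩
  sum c ∎
  where open ≡-Reasoning

fibre-term-≥ : ∀ {m n} (c : Fin m → ℕ) (f : Fin m → Fin n) {i y} → f i ≡ y →
               c i ≤ c i * 𝟙 ⁅ f i ⁆ y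
fibre-term-≥ c f {i} refl = ≤-reflexive (trans (sym (*-identityʳ (c i)))
  (cong (c i *_) (sym (∈⇒𝟙≡1 (x∈⁅x⁆ (f i))))))

fibre-≥ : ∀ {m n} (c : Fin m → ℕ) (f : Fin m → Fin n) {i y} → f i ≡ y → c i ≤ fibre c f y
fibre-≥ c f {i} fi≡y = ≤-trans (fibre-term-≥ c f fi≡y) (term≤sum _ i)

fibre-≥₂ : ∀ {m n} (c : Fin m → ℕ) (f : Fin m → Fin n) {i j y} → i ≢ j →
           f i ≡ y → f j ≡ y → c i + c j ≤ fibre c f y
fibre-≥₂ c f i≢j fi≡y fj≡y = ≤-trans
  (+-mono-≤ (fibre-term-≥ c f fi≡y) (fibre-term-≥ c f fj≡y)) (two-terms≤sum _ i≢j)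

module GroupFacts {n} {_∙_ : Fin n → Fin n → Fin n} {ε : Fin n} {_⁻¹ : Fin n → Fin n}
                  (isGroup : IsGroup _≡_ _∙_ ε _⁻¹) where

  open IsGroup isGroup public using (assoc; identityˡ; identityʳ; inverseˡ; inverseʳ)

  group : Group _ _
  group = record { isGroup = isGroup }

  open import Algebra.Properties.Group group public
    using (inverseˡ-unique; inverseʳ-unique; ⁻¹-involutive; ⁻¹-anti-homo-∙; ε⁻¹≈ε; ⁻¹-injective)

  ⁻¹≢ε : ∀ {x} → x ≢ ε → x ⁻¹ ≢ ε
  ⁻¹≢ε x≢ε x⁻¹≡ε = x≢ε (⁻¹-injective (trans x⁻¹≡ε (sym ε⁻¹≈ε)))

  ∙-cancelʳ : ∀ x y → (x ∙ y) ∙ (y ⁻¹) ≡ x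
  ∙-cancelʳ x y = begin
    (x ∙ y) ∙ (y ⁻¹) ≡⟨ assoc x y (y ⁻¹) ⟩
    x ∙ (y ∙ (y ⁻¹)) ≡⟨ cong (x ∙_) (inverseʳ y) ⟩
    x ∙ ε          ≡⟨ identityʳ x ⟩
    x              ∎
    where open ≡-Reasoning

  rotate : ∀ {x y w} → x ∙ (y ∙ w) ≡ ε → y ∙ (w ∙ x) ≡ ε
  rotate {x} {y} {w} xyw≡ε = begin
    y ∙ (w ∙ x)  ≡⟨ assoc y w x ⟨
    (y ∙ w) ∙ x  ≡⟨ cong (_∙ x) (inverseʳ-unique x (y ∙ w) xyw≡ε) ⟩
    (x ⁻¹) ∙ x   ≡⟨ inverseˡ x ⟩
    ε            ∎
    where open ≡-Reasoning

  pow-2 : ∀ x → pow _∙_ ε x 2 ≡ x ∙ x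
  pow-2 x = cong (x ∙_) (identityʳ x)

  pow-3 : ∀ x → pow _∙_ ε x 3 ≡ x ∙ (x ∙ x)
  pow-3 x = cong (x ∙_) (pow-2 x)

  order-2 : ∀ {x} → HasOrder _∙_ ε x 2 → x ≢ ε × x ∙ x ≡ ε
  order-2 {x} (_ , x²≡ε , minimal) =
    minimal 1 ≤-refl ≤-refl ∘ trans (identityʳ x) , trans (sym (pow-2 x)) x²≡ε

  order-3 : ∀ {x} → HasOrder _∙_ ε x 3 → x ∙ (x ∙ x) ≡ ε
  order-3 {x} (_ , x³≡ε , _) = trans (sym (pow-3 x)) x³≡ε

  order-4 : ∀ {x} → HasOrder _∙_ ε x 4 → x ∙ x ≢ ε × (x ∙ x) ∙ (x ∙ x) ≡ ε
  order-4 {x} (_ , x⁴≡ε , minimal) =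
    minimal 2 (s≤s z≤n) (s≤s (s≤s (s≤s z≤n))) ∘ trans (pow-2 x) ,
    trans (assoc x x (x ∙ x)) (trans (cong (x ∙_) (sym (pow-3 x))) x⁴≡ε)

  hasOrder-3 : ∀ {x} → x ≢ ε → x ∙ x ≢ ε → x ∙ (x ∙ x) ≡ ε → HasOrder _∙_ ε x 3
  hasOrder-3 {x} x≢ε x²≢ε x³≡ε = s≤s z≤n , trans (pow-3 x) x³≡ε , minimal
    where
    minimal : ∀ j → 1 ≤ j → j < 3 → pow _∙_ ε x j ≢ ε
    minimal 1 _ _ = x≢ε ∘ trans (sym (identityʳ x))
    minimal 2 _ _ = x²≢ε ∘ trans (sym (pow-2 x))
    minimal (suc (suc (suc _))) _ (s≤s (s≤s (s≤s ())))

  order≥4 : ∀ {x} → x ≢ ε → x ∙ x ≢ ε → x ∙ (x ∙ x) ≢ ε → ∀ k → HasOrder _∙_ ε x k → 4 ≤ k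
  order≥4 x≢ε x²≢ε x³≢ε 0 (() , _)
  order≥4 {x} x≢ε x²≢ε x³≢ε 1 (_ , x¹≡ε , _) = contradiction (trans (sym (identityʳ x)) x¹≡ε) x≢ε
  order≥4 x≢ε x²≢ε x³≢ε 2 hasOrder = contradiction (proj₂ (order-2 hasOrder)) x²≢ε
  order≥4 x≢ε x²≢ε x³≢ε 3 hasOrder = contradiction (order-3 hasOrder) x³≢ε
  order≥4 x≢ε x²≢ε x³≢ε (suc (suc (suc (suc k)))) _ = s≤s (s≤s (s≤s (s≤s z≤n)))

module CayleyMoore
  {n r z : ℕ} {_∙_ : Fin n → Fin n → Fin n} {ε : Fin n} {_⁻¹ : Fin n → Fin n}
  (isGroup : IsGroup _≡_ _∙_ ε _⁻¹) (n≡moore : n ≡ (r + z) ^ 2 + z + 1)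
  {S₁ S₂ : Subset n} (ε∉S₁ : ε ∉ S₁) (ε∉S₂ : ε ∉ S₂) (S₁∩S₂≡∅ : ∀ s → s ∈ S₁ → s ∉ S₂)
  (S₁-symmetric : ∀ s → s ∈ S₁ → (s ⁻¹) ∈ S₁) (S₂-asymmetric : ∀ s → s ∈ S₂ → (s ⁻¹) ∉ S₂)
  (∣S₁∣≡r : ∣ S₁ ∣ ≡ r) (∣S₂∣≡z : ∣ S₂ ∣ ≡ z)
  (diameter≤2 : ∀ u v → Within (Cay _∙_ S₁ S₂) 2 u v)
  where

  open GroupFacts isGroup

  S : Subset n
  S = S₁ ∪ S₂

  S₁⊆S : ∀ {s} → s ∈ S₁ → s ∈ S
  S₁⊆S = x∈p∪q⁺ ∘ inj₁

  S₂⊆S : ∀ {s} → s ∈ S₂ → s ∈ S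
  S₂⊆S = x∈p∪q⁺ ∘ inj₂

  ∈S⇒≢ε : ∀ {s} → s ∈ S → s ≢ ε
  ∈S⇒≢ε s∈S refl with x∈p∪q⁻ S₁ S₂ s∈S
  ... | inj₁ ε∈S₁ = ε∉S₁ ε∈S₁
  ... | inj₂ ε∈S₂ = ε∉S₂ ε∈S₂

  step⇒generator : ∀ {u v} → Step (Cay _∙_ S₁ S₂) u v → ∃ λ s → s ∈ S × v ≡ u ∙ s
  step⇒generator (inj₁ (s , s∈S₁ , v≡us)) = s , S₁⊆S s∈S₁ , v≡us
  step⇒generator {u} (inj₂ (inj₁ (s , s∈S₁ , u≡vs))) =
    s ⁻¹ , S₁⊆S (S₁-symmetric s s∈S₁) ,
    trans (sym (∙-cancelʳ _ s)) (cong (_∙ (s ⁻¹)) (sym u≡vs))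
  step⇒generator (inj₂ (inj₂ (s , s∈S₂ , v≡us))) = s , S₂⊆S s∈S₂ , v≡us

  first-step : ∀ {v} → Step (Cay _∙_ S₁ S₂) ε v → v ∈ S
  first-step step with step⇒generator step
  ... | s , s∈S , v≡εs = subst (_∈ S) (sym (trans v≡εs (identityˡ s))) s∈S

  short-product : ∀ g → g ≢ ε → g ∈ S ⊎ ∃₂ λ s t → s ∈ S × t ∈ S × g ≡ s ∙ t
  short-product g g≢ε with diameter≤2 ε g
  ... | inj₁ (inj₁ ε≡g)                    = contradiction (sym ε≡g) g≢ε
  ... | inj₁ (inj₂ (v , step , refl))      = inj₁ (first-step step)
  ... | inj₂ (v , step , inj₁ refl)        = inj₁ (first-step step)
  ... | inj₂ (v , step , inj₂ (_ , step′ , refl)) with step⇒generator step′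
  ...   | t , t∈S , g≡vt = inj₂ (v , t , first-step step , t∈S , g≡vt)

  -- The indicator of S, written so that its sum is visibly r + z.
  weight : Fin n → ℕ
  weight s = 𝟙 S₁ s + 𝟙 S₂ s

  1≤weight : ∀ {s} → s ∈ S → 1 ≤ weight s
  1≤weight {s} s∈S with x∈p∪q⁻ S₁ S₂ s∈S
  ... | inj₁ s∈S₁ = ≤-trans (≤-reflexive (sym (∈⇒𝟙≡1 s∈S₁))) (m≤m+n _ (𝟙 S₂ s))
  ... | inj₂ s∈S₂ = ≤-trans (≤-reflexive (sym (∈⇒𝟙≡1 s∈S₂))) (m≤n+m _ (𝟙 S₁ s))

  sum-weight : sum weight ≡ r + z
  sum-weight = trans (∑-distrib-+ (𝟙 S₁) (𝟙 S₂))
    (cong₂ _+_ (trans (sum-𝟙 S₁) ∣S₁∣≡r) (trans (sum-𝟙 S₂) ∣S₂∣≡z))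

  𝟙⁅ε⁆-≢ε : ∀ {g} → g ≢ ε → 𝟙 ⁅ ε ⁆ g ≡ 0
  𝟙⁅ε⁆-≢ε g≢ε = ∉⇒𝟙≡0 (g≢ε ∘ x∈⁅y⁆⇒x≡y ε)

  𝟙⁅ε⁆-ε : 𝟙 ⁅ ε ⁆ ε ≡ 1
  𝟙⁅ε⁆-ε = ∈⇒𝟙≡1 (x∈⁅x⁆ ε)

  sum-𝟙⁅ε⁆ : sum (𝟙 ⁅ ε ⁆) ≡ 1
  sum-𝟙⁅ε⁆ = trans (sum-𝟙 ⁅ ε ⁆) (∣⁅x⁆∣≡1 ε)

  words₁ : Fin n → ℕ
  words₁ = fibre weight id

  words₂ : Fin n → ℕ
  words₂ g = sum (λ s → weight s * fibre weight (s ∙_) g)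

  words : Fin n → ℕ
  words g = 𝟙 ⁅ ε ⁆ g + (words₁ g + words₂ g)

  sum-words₂ : sum words₂ ≡ (r + z) * (r + z)
  sum-words₂ = begin
    sum (λ g → sum (λ s → weight s * fibre weight (s ∙_) g))
      ≡⟨ ∑-comm (λ g s → weight s * fibre weight (s ∙_) g) ⟩
    sum (λ s → sum (λ g → weight s * fibre weight (s ∙_) g))
      ≡⟨ sum-cong-≗ (λ s → sym (*-distribˡ-sum (weight s) (fibre weight (s ∙_)))) ⟩
    sum (λ s → weight s * sum (fibre weight (s ∙_)))
      ≡⟨ sum-cong-≗ (λ s → cong (weight s *_) (trans (sum-fibre weight (s ∙_)) sum-weight)) ⟩
    sum (λ s → weight s * (r + z))
      ≡⟨ sym (*-distribʳ-sum (r + z) weight) ⟩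
    sum weight * (r + z)
      ≡⟨ cong (_* (r + z)) sum-weight ⟩
    (r + z) * (r + z) ∎
    where open ≡-Reasoning

  sum-words : sum words ≡ 1 + ((r + z) + (r + z) * (r + z))
  sum-words = begin
    sum words
      ≡⟨ ∑-distrib-+ (𝟙 ⁅ ε ⁆) (λ g → words₁ g + words₂ g) ⟩
    sum (𝟙 ⁅ ε ⁆) + sum (λ g → words₁ g + words₂ g)
      ≡⟨ cong₂ _+_ sum-𝟙⁅ε⁆ (∑-distrib-+ words₁ words₂) ⟩
    1 + (sum words₁ + sum words₂)
      ≡⟨ cong₂ (λ a b → 1 + (a + b)) (trans (sum-fibre weight id) sum-weight) sum-words₂ ⟩
    1 + ((r + z) + (r + z) * (r + z)) ∎
    where open ≡-Reasoning

  lowerBound : Fin n → ℕ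
  lowerBound g = 1 + r * 𝟙 ⁅ ε ⁆ g

  lowerBound-≢ε : ∀ {g} → g ≢ ε → lowerBound g ≡ 1
  lowerBound-≢ε g≢ε = cong suc (trans (cong (r *_) (𝟙⁅ε⁆-≢ε g≢ε)) (*-zeroʳ r))

  sum-lowerBound : sum lowerBound ≡ 1 + ((r + z) + (r + z) * (r + z))
  sum-lowerBound = begin
    sum lowerBound
      ≡⟨ ∑-distrib-+ {n} (λ _ → 1) (λ g → r * 𝟙 ⁅ ε ⁆ g) ⟩
    sum {n} (λ _ → 1) + sum (λ g → r * 𝟙 ⁅ ε ⁆ g)
      ≡⟨ cong₂ _+_ sum-const-1 (sym (*-distribˡ-sum r (𝟙 ⁅ ε ⁆))) ⟩
    n + r * sum (𝟙 ⁅ ε ⁆)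
      ≡⟨ cong₂ (λ m k → m + r * k) n≡moore sum-𝟙⁅ε⁆ ⟩
    (r + z) ^ 2 + z + 1 + r * 1
      ≡⟨ moore-count r z ⟩
    1 + ((r + z) + (r + z) * (r + z)) ∎
    where
    open ≡-Reasoning
    moore-count : ∀ r z →
      (r + z) * ((r + z) * 1) + z + 1 + r * 1 ≡ 1 + ((r + z) + (r + z) * (r + z))
    moore-count = solve-∀

  words₁-≥ : ∀ {u} → u ∈ S → 1 ≤ words₁ u
  words₁-≥ u∈S = ≤-trans (1≤weight u∈S) (fibre-≥ weight id refl)

  words₂-term-≥ : ∀ {s t g} → s ∈ S → t ∈ S → s ∙ t ≡ g → 1 ≤ weight s * fibre weight (s ∙_) g
  words₂-term-≥ {s} s∈S t∈S st≡g =
    *-mono-≤ (1≤weight s∈S) (≤-trans (1≤weight t∈S) (fibre-≥ weight (s ∙_) st≡g))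

  words₂-≥ : ∀ {s t} → s ∈ S → t ∈ S → 1 ≤ words₂ (s ∙ t)
  words₂-≥ {s} s∈S t∈S = ≤-trans (words₂-term-≥ s∈S t∈S refl) (term≤sum _ s)

  fibre≤words₂ : ∀ {s} g → s ∈ S → fibre weight (s ∙_) g ≤ words₂ g
  fibre≤words₂ {s} g s∈S = ≤-trans
    (≤-trans (≤-reflexive (sym (*-identityˡ _))) (*-monoˡ-≤ _ (1≤weight s∈S)))
    (term≤sum _ s)

  r≤words₂-ε : r ≤ words₂ ε
  r≤words₂-ε = begin
    r             ≡⟨ trans (sym ∣S₁∣≡r) (sym (sum-𝟙 S₁)) ⟩
    sum (𝟙 S₁)    ≤⟨ sum-mono-≤ (λ s → 𝟙≤ (λ s∈S₁ → words₂-term-≥ (S₁⊆S s∈S₁)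
                       (S₁⊆S (S₁-symmetric s s∈S₁)) (inverseʳ s))) ⟩
    words₂ ε      ∎
    where open ≤-Reasoning

  lowerBound≤words : ∀ g → lowerBound g ≤ words g
  lowerBound≤words g with g ≟ ε
  ... | yes refl = begin
    1 + r * 𝟙 ⁅ ε ⁆ ε ≡⟨ cong (λ k → 1 + r * k) 𝟙⁅ε⁆-ε ⟩
    1 + r * 1         ≡⟨ cong suc (*-identityʳ r) ⟩
    1 + r             ≤⟨ +-mono-≤ (≤-reflexive (sym 𝟙⁅ε⁆-ε)) (≤-trans r≤words₂-ε (m≤n+m _ _)) ⟩
    words ε           ∎
    where open ≤-Reasoning
  ... | no g≢ε = begin
    lowerBound g        ≡⟨ lowerBound-≢ε g≢ε ⟩
    1                   ≤⟨ word-exists (short-product g g≢ε) ⟩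
    words₁ g + words₂ g ≤⟨ m≤n+m _ (𝟙 ⁅ ε ⁆ g) ⟩
    words g             ∎
    where
    open ≤-Reasoning
    word-exists : g ∈ S ⊎ ∃₂ (λ s t → s ∈ S × t ∈ S × g ≡ s ∙ t) → 1 ≤ words₁ g + words₂ g
    word-exists (inj₁ g∈S)                       = ≤-trans (words₁-≥ g∈S) (m≤m+n _ _)
    word-exists (inj₂ (s , t , s∈S , t∈S , refl)) = ≤-trans (words₂-≥ s∈S t∈S) (m≤n+m _ _)

  -- The counts words and lowerBound have the same total, so they agree everywhere.
  words≤1 : ∀ {g} → g ≢ ε → words₁ g + words₂ g ≤ 1
  words≤1 {g} g≢ε = begin
    words₁ g + words₂ g ≡⟨ cong (_+ (words₁ g + words₂ g)) (𝟙⁅ε⁆-≢ε g≢ε) ⟨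
    words g             ≤⟨ sum-mono-≤-tight lowerBound≤words
                             (≤-reflexive (trans sum-words (sym sum-lowerBound))) g ⟩
    lowerBound g        ≡⟨ lowerBound-≢ε g≢ε ⟩
    1                   ∎
    where open ≤-Reasoning

  words₂≤1 : ∀ {g} → g ≢ ε → words₂ g ≤ 1
  words₂≤1 {g} g≢ε = ≤-trans (m≤n+m (words₂ g) (words₁ g)) (words≤1 g≢ε)

  product-free : ∀ s t u → s ∈ S → t ∈ S → u ∈ S → u ≢ s ∙ t
  product-free s t u s∈S t∈S u∈S refl = n≮n 1 (≤-trans
    (+-mono-≤ (words₁-≥ u∈S) (words₂-≥ s∈S t∈S)) (words≤1 (∈S⇒≢ε u∈S)))

  unique-products : ∀ s₁ s₂ t₁ t₂ → s₁ ∈ S → s₂ ∈ S → t₁ ∈ S → t₂ ∈ S →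
                    s₁ ∙ s₂ ≡ t₁ ∙ t₂ → s₁ ∙ s₂ ≢ ε → s₁ ≡ t₁ × s₂ ≡ t₂
  -- Distinct first letters give two terms of words₂, equal ones two points of one fibre.
  unique-products s₁ s₂ t₁ t₂ s₁∈S s₂∈S t₁∈S t₂∈S s₁s₂≡t₁t₂ s₁s₂≢ε with s₁ ≟ t₁
  ... | no s₁≢t₁ = contradiction (≤-trans
    (≤-trans (+-mono-≤ (words₂-term-≥ s₁∈S s₂∈S refl)
                       (words₂-term-≥ t₁∈S t₂∈S (sym s₁s₂≡t₁t₂)))
             (two-terms≤sum _ s₁≢t₁))
    (words₂≤1 s₁s₂≢ε)) (n≮n 1)
  ... | yes refl with s₂ ≟ t₂
  ...   | yes s₂≡t₂ = refl , s₂≡t₂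
  ...   | no s₂≢t₂ = contradiction (≤-trans
    (≤-trans (+-mono-≤ (1≤weight s₂∈S) (1≤weight t₂∈S))
             (fibre-≥₂ weight (s₁ ∙_) s₂≢t₂ refl (sym s₁s₂≡t₁t₂)))
    (≤-trans (fibre≤words₂ _ s₁∈S) (words₂≤1 s₁s₂≢ε))) (n≮n 1)

  S₂-inverse∉S : ∀ {s} → s ∈ S₂ → (s ⁻¹) ∉ S
  S₂-inverse∉S {s} s∈S₂ s⁻¹∈S with x∈p∪q⁻ S₁ S₂ s⁻¹∈S
  ... | inj₁ s⁻¹∈S₁ =
    S₁∩S₂≡∅ s (subst (_∈ S₁) (⁻¹-involutive s) (S₁-symmetric (s ⁻¹) s⁻¹∈S₁)) s∈S₂
  ... | inj₂ s⁻¹∈S₂ = S₂-asymmetric s s∈S₂ s⁻¹∈S₂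

  S₂-square≢ε : ∀ {s} → s ∈ S₂ → s ∙ s ≢ ε
  S₂-square≢ε {s} s∈S₂ s²≡ε =
    S₂-asymmetric s s∈S₂ (subst (_∈ S₂) (inverseʳ-unique s s s²≡ε) s∈S₂)

  -- An involution a b equals (a b)⁻¹ = b⁻¹ a⁻¹, so a = b⁻¹ by unique products.
  S₁-product-not-involution : ∀ {a b} → a ∈ S₁ → b ∈ S₁ → a ∙ b ≢ ε → (a ∙ b) ∙ (a ∙ b) ≢ ε
  S₁-product-not-involution {a} {b} a∈S₁ b∈S₁ ab≢ε abab≡ε =
    ab≢ε (trans (cong (_∙ b) a≡b⁻¹) (inverseˡ b))
    where
    a≡b⁻¹ : a ≡ b ⁻¹
    a≡b⁻¹ = proj₁ (unique-products a b (b ⁻¹) (a ⁻¹)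
      (S₁⊆S a∈S₁) (S₁⊆S b∈S₁) (S₁⊆S (S₁-symmetric b b∈S₁)) (S₁⊆S (S₁-symmetric a a∈S₁))
      (trans (inverseʳ-unique (a ∙ b) (a ∙ b) abab≡ε) (⁻¹-anti-homo-∙ a b)) ab≢ε)

  S₁-orders : ∀ s → s ∈ S₁ → ¬ HasOrder _∙_ ε s 3 × ¬ HasOrder _∙_ ε s 4
  S₁-orders s s∈S₁ = no-order-3 , no-order-4
    where
    no-order-3 : ¬ HasOrder _∙_ ε s 3
    no-order-3 hasOrder = product-free s s (s ⁻¹) (S₁⊆S s∈S₁) (S₁⊆S s∈S₁)
      (S₁⊆S (S₁-symmetric s s∈S₁)) (sym (inverseʳ-unique s (s ∙ s) (order-3 hasOrder)))
    no-order-4 : ¬ HasOrder _∙_ ε s 4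
    no-order-4 hasOrder = uncurry (S₁-product-not-involution s∈S₁ s∈S₁) (order-4 hasOrder)

  S₂-no-involution : ∀ s → s ∈ S₂ → ¬ HasOrder _∙_ ε s 2
  S₂-no-involution s s∈S₂ hasOrder = S₂-square≢ε s∈S₂ (proj₂ (order-2 hasOrder))

  S₁-products-no-involution : ∀ s t → s ∈ S₁ → t ∈ S₁ → ¬ HasOrder _∙_ ε (s ∙ t) 2
  S₁-products-no-involution s t s∈S₁ t∈S₁ hasOrder =
    uncurry (S₁-product-not-involution s∈S₁ t∈S₁) (order-2 hasOrder)

  commuting-generators : ∀ s t → s ∈ S → t ∈ S → s ≢ t → s ∙ t ≡ t ∙ s → s ∈ S₁ × t ≡ s ⁻¹
  commuting-generators s t s∈S t∈S s≢t st≡ts with s ∙ t ≟ ε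
  ... | no st≢ε =
    contradiction (proj₁ (unique-products s t t s s∈S t∈S t∈S s∈S st≡ts st≢ε)) s≢t
  ... | yes st≡ε with x∈p∪q⁻ S₁ S₂ s∈S
  ...   | inj₁ s∈S₁ = s∈S₁ , inverseʳ-unique s t st≡ε
  ...   | inj₂ s∈S₂ =
    contradiction (subst (_∈ S) (inverseʳ-unique s t st≡ε) t∈S) (S₂-inverse∉S s∈S₂)

  -- Both p q and q p equal q⁻¹.
  p∙q²≢ε : ∀ {p q} → p ∈ S → q ∈ S → p ≢ q → p ∙ (q ∙ q) ≢ ε
  p∙q²≢ε {p} {q} p∈S q∈S p≢q pqq≡ε =
    p≢q (proj₁ (unique-products p q q p p∈S q∈S q∈S p∈S (trans pq≡q⁻¹ (sym qp≡q⁻¹)) pq≢ε))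
    where
    pq≡q⁻¹ : p ∙ q ≡ q ⁻¹
    pq≡q⁻¹ = inverseˡ-unique (p ∙ q) q (trans (assoc p q q) pqq≡ε)
    qp≡q⁻¹ : q ∙ p ≡ q ⁻¹
    qp≡q⁻¹ = inverseʳ-unique q (q ∙ p) (rotate pqq≡ε)
    pq≢ε : p ∙ q ≢ ε
    pq≢ε = ⁻¹≢ε (∈S⇒≢ε q∈S) ∘ trans (sym pq≡q⁻¹)

  -- Both p p and q u equal p⁻¹.
  cube≢ε : ∀ {p q u} → p ∈ S → q ∈ S → u ∈ S → p ≢ q → p ∙ (q ∙ u) ≡ ε → p ∙ (p ∙ p) ≢ ε
  cube≢ε {p} {q} {u} p∈S q∈S u∈S p≢q pqu≡ε ppp≡ε =
    p≢q (proj₁ (unique-products p p q u p∈S p∈S q∈S u∈S (trans pp≡p⁻¹ (sym qu≡p⁻¹)) pp≢ε))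
    where
    pp≡p⁻¹ : p ∙ p ≡ p ⁻¹
    pp≡p⁻¹ = inverseʳ-unique p (p ∙ p) ppp≡ε
    qu≡p⁻¹ : q ∙ u ≡ p ⁻¹
    qu≡p⁻¹ = inverseʳ-unique p (q ∙ u) pqu≡ε
    pp≢ε : p ∙ p ≢ ε
    pp≢ε = ⁻¹≢ε (∈S⇒≢ε p∈S) ∘ trans (sym pp≡p⁻¹)

  relator-in-S₂ : ∀ {p q u} → p ∈ S → q ∈ S → u ∈ S → p ∙ (q ∙ u) ≡ ε → p ∈ S₂
  relator-in-S₂ {p} {q} {u} p∈S q∈S u∈S pqu≡ε with x∈p∪q⁻ S₁ S₂ p∈S
  ... | inj₁ p∈S₁ = contradiction (sym (inverseʳ-unique p (q ∙ u) pqu≡ε))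
                      (product-free q u (p ⁻¹) q∈S u∈S (S₁⊆S (S₁-symmetric p p∈S₁)))
  ... | inj₂ p∈S₂ = p∈S₂

  relator-order≥4 : ∀ {p q u} → p ∈ S₂ → q ∈ S → u ∈ S → p ≢ q → p ∙ (q ∙ u) ≡ ε →
                    ∀ k → HasOrder _∙_ ε p k → 4 ≤ k
  relator-order≥4 p∈S₂ q∈S u∈S p≢q pqu≡ε =
    order≥4 (∈S⇒≢ε (S₂⊆S p∈S₂)) (S₂-square≢ε p∈S₂) (cube≢ε (S₂⊆S p∈S₂) q∈S u∈S p≢q pqu≡ε)

  InLargeOrderTriple : Fin n → Set
  InLargeOrderTriple a =
    ∃ λ x → ∃ λ y → ∃ λ w →
      x ∈ S₂ × y ∈ S₂ × w ∈ S₂ × x ≢ y × y ≢ w × x ≢ w ×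
      (∀ k → HasOrder _∙_ ε x k → 4 ≤ k) ×
      (∀ k → HasOrder _∙_ ε y k → 4 ≤ k) ×
      (∀ k → HasOrder _∙_ ε w k → 4 ≤ k) ×
      (x ∙ y) ⁻¹ ≡ w ×
      (a ≡ x ⊎ a ≡ y ⊎ a ≡ w)

  S₂-relator : ∀ {a x y} → a ∈ S₂ → x ∈ S → y ∈ S → a ∙ (x ∙ y) ≡ ε →
    HasOrder _∙_ ε a 3 ⊎ InLargeOrderTriple a
  S₂-relator {a} {x} {y} a∈S₂ x∈S y∈S axy≡ε with x ≟ a | y ≟ a
  ... | yes refl | yes refl =
    inj₁ (hasOrder-3 (∈S⇒≢ε (S₂⊆S a∈S₂)) (S₂-square≢ε a∈S₂) axy≡ε)
  ... | yes refl | no y≢a = contradiction (rotate (rotate axy≡ε)) (p∙q²≢ε y∈S (S₂⊆S a∈S₂) y≢a)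
  ... | no x≢a | yes refl = contradiction (rotate axy≡ε) (p∙q²≢ε x∈S (S₂⊆S a∈S₂) x≢a)
  ... | no x≢a | no y≢a with x ≟ y
  ...   | yes refl = contradiction axy≡ε (p∙q²≢ε (S₂⊆S a∈S₂) x∈S (x≢a ∘ sym))
  ...   | no x≢y = inj₂ (x , y , a , x∈S₂ , y∈S₂ , a∈S₂ , x≢y , y≢a , x≢a ,
                          relator-order≥4 x∈S₂ y∈S a∈S x≢y xya≡ε ,
                          relator-order≥4 y∈S₂ a∈S x∈S y≢a yax≡ε ,
                          relator-order≥4 a∈S₂ x∈S y∈S (x≢a ∘ sym) axy≡ε ,
                          sym (inverseˡ-unique a (x ∙ y) axy≡ε) , inj₂ (inj₂ refl))
    where
    a∈S : a ∈ S
    a∈S = S₂⊆S a∈S₂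
    xya≡ε : x ∙ (y ∙ a) ≡ ε
    xya≡ε = rotate axy≡ε
    yax≡ε : y ∙ (a ∙ x) ≡ ε
    yax≡ε = rotate xya≡ε
    x∈S₂ : x ∈ S₂
    x∈S₂ = relator-in-S₂ x∈S y∈S a∈S xya≡ε
    y∈S₂ : y ∈ S₂
    y∈S₂ = relator-in-S₂ y∈S a∈S x∈S yax≡ε

  S₂-elements : ∀ a → a ∈ S₂ → HasOrder _∙_ ε a 3 ⊎ InLargeOrderTriple a
  S₂-elements a a∈S₂ with short-product (a ⁻¹) (⁻¹≢ε (∈S⇒≢ε (S₂⊆S a∈S₂)))
  ... | inj₁ a⁻¹∈S = contradiction a⁻¹∈S (S₂-inverse∉S a∈S₂)
  ... | inj₂ (x , y , x∈S , y∈S , a⁻¹≡xy) =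
    S₂-relator a∈S₂ x∈S y∈S (trans (cong (a ∙_) (sym a⁻¹≡xy)) (inverseʳ a))

proposition2 :
    (n r z : ℕ) (_∙_ : Fin n → Fin n → Fin n) (ε : Fin n) (_⁻¹ : Fin n → Fin n) →
    IsGroup _≡_ _∙_ ε _⁻¹ →
    n ≡ (r + z) ^ 2 + z + 1 →
    (S₁ S₂ : Subset n) →
    ε ∉ S₁ → ε ∉ S₂ →
    (∀ s → s ∈ S₁ → s ∉ S₂) →
    (∀ s → s ∈ S₁ → (s ⁻¹) ∈ S₁) →
    (∀ s → s ∈ S₂ → (s ⁻¹) ∉ S₂) →
    ∣ S₁ ∣ ≡ r → ∣ S₂ ∣ ≡ z →
    MixedMoore2 (Cay _∙_ S₁ S₂) r z →
    let S = S₁ ∪ S₂ in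
    -- (i)
    (∀ s → s ∈ S₁ → ¬ HasOrder _∙_ ε s 3 × ¬ HasOrder _∙_ ε s 4) ×
    -- (ii)
    (∀ s → s ∈ S₂ → ¬ HasOrder _∙_ ε s 2) ×
    -- (iii)
    (∀ s t → s ∈ S₁ → t ∈ S₁ → ¬ HasOrder _∙_ ε (s ∙ t) 2) ×
    -- (iv)
    (∀ s t → s ∈ S → t ∈ S → s ≢ t → s ∙ t ≡ t ∙ s → s ∈ S₁ × t ≡ s ⁻¹) ×
    -- (v)
    (∀ s t u → s ∈ S → t ∈ S → u ∈ S → u ≢ s ∙ t) ×
    -- (vi)
    (∀ s₁ s₂ t₁ t₂ → s₁ ∈ S → s₂ ∈ S → t₁ ∈ S → t₂ ∈ S →
      s₁ ∙ s₂ ≡ t₁ ∙ t₂ → s₁ ∙ s₂ ≢ ε → s₁ ≡ t₁ × s₂ ≡ t₂) ×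
    -- (vii)
    (∀ a → a ∈ S₂ →
      HasOrder _∙_ ε a 3 ⊎
      (∃ λ x → ∃ λ y → ∃ λ w →
        x ∈ S₂ × y ∈ S₂ × w ∈ S₂ × x ≢ y × y ≢ w × x ≢ w ×
        (∀ k → HasOrder _∙_ ε x k → 4 ≤ k) ×
        (∀ k → HasOrder _∙_ ε y k → 4 ≤ k) ×
        (∀ k → HasOrder _∙_ ε w k → 4 ≤ k) ×
        (x ∙ y) ⁻¹ ≡ w ×
        (a ≡ x ⊎ a ≡ y ⊎ a ≡ w)))
proposition2 n r z _∙_ ε _⁻¹ isGroup n≡moore S₁ S₂ ε∉S₁ ε∉S₂ S₁∩S₂≡∅ S₁-symmetric S₂-asymmetric
             ∣S₁∣≡r ∣S₂∣≡z ((diameter≤2 , _) , _) =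
  S₁-orders , S₂-no-involution , S₁-products-no-involution , commuting-generators ,
  product-free , unique-products , S₂-elements
  where
  open CayleyMoore isGroup n≡moore ε∉S₁ ε∉S₂ S₁∩S₂≡∅ S₁-symmetric S₂-asymmetric
                   ∣S₁∣≡r ∣S₂∣≡z diameter≤2
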